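{- Let $G$ be a finite bipartite graph with vertex classes $F$ and $W$ (edges written $fw$, $f\in F$, $w\in W$), and let $A,B$ be disjoint nonempty subsets of its edge set. Let $J$ be the set of vertices incident to edges of $A\cup B$, and for $v\in J$ let $A_v$ ($B_v$) be the set of edges of $A$ (resp. $B$) incident to $v$. Suppose that for each edge $fw\in A$ the set $B_w$ is nonempty, and for each edge $fw\in B$ the set $A_f$ is nonempty. Then there exist nonzero functions $\alpha:A\to\mathbb R_+$ and $\beta:B\to\mathbb R_+$ such that: (i) for each $v\in J$, $\sum_{e\in A_v}\alpha(e)=\sum_{e\in B_v}\beta(e)$; (ii) for each $f\in J\cap F$, $\alpha$ takes equal values on all edges of $A_f$, and for each $w\in J\cap W$, $\beta$ takes equal values on all edges of $B_w$. -}

module Defs where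

open import Data.Nat using (ℕ; zero; suc)
open import Data.Fin using (Fin; zero; suc)
open import Data.Bool using (Bool; true; false; if_then_else_)
open import Data.Product using (Σ; ∃-syntax; _×_)
open import Data.Sum using (_⊎_)
open import Relation.Binary.PropositionalEquality using (_≡_; _≢_)
open import Relation.Nullary using (¬_)
open import Data.Rational using (ℚ; 0ℚ; _+_; _≤_)

-- A set of edges of a bipartite graph with vertex classes F = Fin m and
-- W = Fin n: an edge fw is present iff S f w ≡ true.
EdgeSet : ℕ → ℕ → Set
EdgeSet m n = Fin m → Fin n → Bool

_∋_,_ : ∀ {m n} → EdgeSet m n → Fin m → Fin n → Set
S ∋ f , w = S f w ≡ true

_⊆ₑ_ : ∀ {m n} → EdgeSet m n → EdgeSet m n → Set
S ⊆ₑ T = ∀ f w → S ∋ f , w → T ∋ f , w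

Disjointₑ : ∀ {m n} → EdgeSet m n → EdgeSet m n → Set
Disjointₑ S T = ∀ f w → S ∋ f , w → ¬ (T ∋ f , w)

NonEmptyₑ : ∀ {m n} → EdgeSet m n → Set
NonEmptyₑ S = ∃[ f ] ∃[ w ] (S ∋ f , w)

sumℚ : ∀ k → (Fin k → ℚ) → ℚ
sumℚ zero g = 0ℚ
sumℚ (suc k) g = g zero + sumℚ k (λ i → g (suc i))

sumAtF : ∀ {m n} → EdgeSet m n → (Fin m → Fin n → ℚ) → Fin m → ℚ
sumAtF {m} {n} S α f = sumℚ n (λ w → if S f w then α f w else 0ℚ)

sumAtW : ∀ {m n} → EdgeSet m n → (Fin m → Fin n → ℚ) → Fin n → ℚ
sumAtW {m} {n} S α w = sumℚ m (λ f → if S f w then α f w else 0ℚ)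

InJF : ∀ {m n} → EdgeSet m n → EdgeSet m n → Fin m → Set
InJF A B f = ∃[ w ] (A ∋ f , w ⊎ B ∋ f , w)

InJW : ∀ {m n} → EdgeSet m n → EdgeSet m n → Fin n → Set
InJW A B w = ∃[ f ] (A ∋ f , w ⊎ B ∋ f , w)

-- a function on the edge set S (values off S are irrelevant) with values in
-- ℚ_+ (nonnegative) that is not identically zero on S
NonnegNonzeroOn : ∀ {m n} → EdgeSet m n → (Fin m → Fin n → ℚ) → Set
NonnegNonzeroOn S α =
  (∀ f w → S ∋ f , w → 0ℚ ≤ α f w) × (∃[ f ] ∃[ w ] (S ∋ f , w × α f w ≢ 0ℚ))

{-# OPTIONS --safe #-}
-- View the A-edges as arcs f → w and the B-edges as arcs w → f of a digraph on F ⊔ W.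
-- The hypotheses say that every arc ends at a vertex with an outgoing arc, and then the
-- random walk on this digraph has a stationary measure π: at every vertex j the inflow
-- Σᵢ πᵢ Mᵢⱼ (Mᵢⱼ the weight of the arc i → j) equals the outflow πⱼ · outdeg j. Such a π is found by eliminating the
-- vertices one at a time (passing to the stochastic complement, scaled to stay in ℕ).
-- Setting α(fw) = π f and β(fw) = π w, balance at f and at w is (i), and (ii) holds
-- because α depends only on f and β only on w.
module Submission where

open import Defs
open import Data.Nat using (ℕ; zero; suc; _+_; _*_)
open import Data.Nat.Properties
  using (+-*-semiring; _≟_; +-assoc; +-comm; +-identityʳ; *-identityˡ; *-identityʳ; *-zeroʳ;
         *-assoc; *-comm; m+n≡0⇒m≡0; m+n≡0⇒n≡0; m*n≡0⇒m≡0∨n≡0)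
open import Data.Nat.Tactic.RingSolver using (solve-∀)
open import Algebra.Properties.Semiring.Sum +-*-semiring
  using (sum; sum-cong-≗; sum-replicate-zero; ∑-distrib-+; *-distribˡ-sum)
open import Data.Fin using (Fin; zero; suc; _↑ˡ_; _↑ʳ_; splitAt; join)
open import Data.Fin.Properties using (splitAt-↑ˡ; splitAt-↑ʳ; join-splitAt; ¬∀⟶∃¬)
open import Data.Vec.Functional using (_∷_)
open import Data.Bool using (Bool; true; false; if_then_else_)
open import Data.Product using (Σ-syntax; ∃-syntax; _×_; _,_)
open import Data.Sum using (_⊎_; inj₁; inj₂)
open import Data.Empty using (⊥-elim)
open import Function using (_∘_; _∘₂_)
open import Relation.Nullary using (yes; no)
open import Relation.Nullary.Decidable using (decidable-stable)
open import Relation.Binary.PropositionalEquality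
open import Data.Rational using (ℚ; 0ℚ; 1ℚ; _≤_; NonNegative)
import Data.Rational as ℚ using (_+_)
import Data.Rational.Properties as ℚₚ
open import Algebra.Properties.Monoid.Mult ℚₚ.+-0-monoid using (×-homo-+)
  renaming (_×_ to _·ℚ_)

*-≢0 : ∀ {a b} → a ≢ 0 → b ≢ 0 → a * b ≢ 0
*-≢0 {a} a≢0 b≢0 ab≡0 with m*n≡0⇒m≡0∨n≡0 a ab≡0
... | inj₁ a≡0 = a≢0 a≡0
... | inj₂ b≡0 = b≢0 b≡0

*-≡0⇒≡0 : ∀ {a b} → a ≢ 0 → a * b ≡ 0 → b ≡ 0
*-≡0⇒≡0 {a} a≢0 ab≡0 with m*n≡0⇒m≡0∨n≡0 a ab≡0
... | inj₁ a≡0 = ⊥-elim (a≢0 a≡0)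
... | inj₂ b≡0 = b≡0

*-≡0ʳ : ∀ a {b} → b ≡ 0 → a * b ≡ 0
*-≡0ʳ a b≡0 = trans (cong (a *_) b≡0) (*-zeroʳ a)

sum-≡0 : ∀ {k} {g : Fin k → ℕ} → (∀ i → g i ≡ 0) → sum g ≡ 0
sum-≡0 {k} g≡0 = trans (sum-cong-≗ g≡0) (sum-replicate-zero k)

sum≡0⇒≡0 : ∀ {k} (g : Fin k → ℕ) → sum g ≡ 0 → ∀ i → g i ≡ 0
sum≡0⇒≡0 g Σ≡0 zero    = m+n≡0⇒m≡0 (g zero) Σ≡0
sum≡0⇒≡0 g Σ≡0 (suc i) = sum≡0⇒≡0 (g ∘ suc) (m+n≡0⇒n≡0 (g zero) Σ≡0) i

∃≢0⇒sum≢0 : ∀ {k} {g : Fin k → ℕ} → ∃[ i ] g i ≢ 0 → sum g ≢ 0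
∃≢0⇒sum≢0 {g = g} (i , gi≢0) Σ≡0 = gi≢0 (sum≡0⇒≡0 g Σ≡0 i)

sum≢0⇒∃≢0 : ∀ {k} (g : Fin k → ℕ) → sum g ≢ 0 → ∃[ i ] g i ≢ 0
sum≢0⇒∃≢0 {k} g Σ≢0 = ¬∀⟶∃¬ k (λ i → g i ≡ 0) (λ i → g i ≟ 0) (Σ≢0 ∘ sum-≡0)

sum-*-assoc : ∀ {k} c (π g : Fin k → ℕ) →
              sum (λ i → c * π i * g i) ≡ c * sum (λ i → π i * g i)
sum-*-assoc c π g =
  trans (sum-cong-≗ (λ i → *-assoc c (π i) (g i))) (sym (*-distribˡ-sum c (λ i → π i * g i)))

sum-↑ : ∀ m {n} (g : Fin (m + n) → ℕ) →
        sum g ≡ sum (λ i → g (i ↑ˡ n)) + sum (λ j → g (m ↑ʳ j))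
sum-↑ zero    g = refl
sum-↑ (suc m) g = trans (cong (g zero +_) (sum-↑ m (g ∘ suc))) (sym (+-assoc (g zero) _ _))

data Side (m n : ℕ) : Fin (m + n) → Set where
  inˡ : (i : Fin m) → Side m n (i ↑ˡ n)
  inʳ : (j : Fin n) → Side m n (m ↑ʳ j)

side : ∀ m n (x : Fin (m + n)) → Side m n x
side m n x = subst (Side m n) (join-splitAt m n x) (joined (splitAt m x))
  where
  joined : (s : Fin m ⊎ Fin n) → Side m n (join m n s)
  joined (inj₁ i) = inˡ i
  joined (inj₂ j) = inʳ j

Matrix : ℕ → Set
Matrix N = Fin N → Fin N → ℕ

outDegree : ∀ {N} → Matrix N → Fin N → ℕ
outDegree M i = sum (M i)

inflow : ∀ {N} → Matrix N → (Fin N → ℕ) → Fin N → ℕ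
inflow M π j = sum (λ i → π i * M i j)

Balanced : ∀ {N} → Matrix N → (Fin N → ℕ) → Set
Balanced M π = ∀ j → inflow M π j ≡ π j * outDegree M j

NoArcIntoSink : ∀ {N} → Matrix N → Set
NoArcIntoSink M = ∀ j → outDegree M j ≡ 0 → ∀ i → M i j ≡ 0

NontrivialBalancing : ∀ {N} → Matrix N → Set
NontrivialBalancing M = ∃[ π ] (Balanced M π × ∃[ j ] (π j ≢ 0 × outDegree M j ≢ 0))

balanced-successor : ∀ {N} {M : Matrix N} {π} → Balanced M π →
                     ∀ {j k} → π j ≢ 0 → M j k ≢ 0 → π k ≢ 0 × outDegree M k ≢ 0
balanced-successor {M = M} {π} balanced {j} {k} πj≢0 Mjk≢0 =
    (λ πk≡0 → noInflow (trans (balanced k) (cong (_* outDegree M k) πk≡0)))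
  , (λ outk≡0 → noInflow (trans (balanced k) (*-≡0ʳ (π k) outk≡0)))
  where
  noInflow : inflow M π k ≢ 0
  noInflow inflow≡0 = *-≢0 πj≢0 Mjk≢0 (sum≡0⇒≡0 (λ i → π i * M i k) inflow≡0 j)

minor₀ : ∀ {N} → Matrix (suc N) → Matrix N
minor₀ M i j = M (suc i) (suc j)

module _ {N} (M : Matrix (suc N)) (noArcInto₀ : ∀ i → M i zero ≡ 0) where

  outDegree-minor₀ : ∀ i → outDegree (minor₀ M) i ≡ outDegree M (suc i)
  outDegree-minor₀ i = sym (cong (_+ outDegree (minor₀ M) i) (noArcInto₀ (suc i)))

  noArcIntoSink-minor₀ : NoArcIntoSink M → NoArcIntoSink (minor₀ M)
  noArcIntoSink-minor₀ noArcIntoSink j out≡0 i =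
    noArcIntoSink (suc j) (trans (sym (outDegree-minor₀ j)) out≡0) (suc i)

  balancing-minor₀ : NontrivialBalancing (minor₀ M) → NontrivialBalancing M
  balancing-minor₀ (π , balanced , j , πj≢0 , outj≢0) =
    (0 ∷ π) , balanced′ , suc j , πj≢0 , outj≢0 ∘ trans (outDegree-minor₀ j)
    where
    balanced′ : Balanced M (0 ∷ π)
    balanced′ zero    = sum-≡0 (λ i → *-≡0ʳ (π i) (noArcInto₀ (suc i)))
    balanced′ (suc j) = trans (balanced j) (cong (π j *_) (outDegree-minor₀ j))

exitDegree₀ : ∀ {N} → Matrix (suc N) → ℕ
exitDegree₀ M = sum (λ j → M zero (suc j))

balancing-loop₀ : ∀ {N} (M : Matrix (suc N)) → outDegree M zero ≢ 0 → exitDegree₀ M ≡ 0 →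
                  NontrivialBalancing M
balancing-loop₀ {N} M out₀≢0 exit≡0 = (1 ∷ λ _ → 0) , balanced , zero , (λ ()) , out₀≢0
  where
  inflow≡row₀ : ∀ j → inflow M (1 ∷ λ _ → 0) j ≡ M zero j
  inflow≡row₀ j = trans (cong₂ _+_ (*-identityˡ (M zero j)) (sum-replicate-zero N)) (+-identityʳ _)
  balanced : Balanced M (1 ∷ λ _ → 0)
  balanced zero    = trans (inflow≡row₀ zero) (sym (trans (*-identityˡ _)
                       (trans (cong (M zero zero +_) exit≡0) (+-identityʳ _))))
  balanced (suc j) = trans (inflow≡row₀ (suc j)) (sum≡0⇒≡0 (λ j → M zero (suc j)) exit≡0 j)

-- The stochastic complement of vertex 0, multiplied by d = exitDegree₀ M to stay in ℕ:
-- a walk from i that enters 0 leaves it (ignoring loops at 0) towards j with weight M 0 j / d.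
eliminate₀ : ∀ {N} → Matrix (suc N) → Matrix N
eliminate₀ M i j = exitDegree₀ M * M (suc i) (suc j) + M (suc i) zero * M zero (suc j)

inflowInto₀ : ∀ {N} → Matrix (suc N) → (Fin N → ℕ) → ℕ
inflowInto₀ M π = sum (λ i → π i * M (suc i) zero)

-- Vertex 0 gets the flow that the complement routes through it; the other weights are
-- rescaled by d, matching the factor d in eliminate₀.
lift₀ : ∀ {N} → Matrix (suc N) → (Fin N → ℕ) → Fin (suc N) → ℕ
lift₀ M π = inflowInto₀ M π ∷ λ i → exitDegree₀ M * π i

module _ {N} (M : Matrix (suc N)) where
  private
    d = exitDegree₀ M

  outDegree-eliminate₀ : ∀ i → outDegree (eliminate₀ M) i ≡ d * outDegree M (suc i)
  outDegree-eliminate₀ i = begin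
    sum (λ j → d * M (suc i) (suc j) + M (suc i) zero * M zero (suc j))
      ≡⟨ ∑-distrib-+ (λ j → d * M (suc i) (suc j)) (λ j → M (suc i) zero * M zero (suc j)) ⟩
    sum (λ j → d * M (suc i) (suc j)) + sum (λ j → M (suc i) zero * M zero (suc j))
      ≡⟨ sym (cong₂ _+_ (*-distribˡ-sum d (M (suc i) ∘ suc))
                        (*-distribˡ-sum (M (suc i) zero) (M zero ∘ suc))) ⟩
    d * outDegree (minor₀ M) i + M (suc i) zero * d
      ≡⟨ regroup d (outDegree (minor₀ M) i) (M (suc i) zero) ⟩
    d * outDegree M (suc i) ∎
    where
    open ≡-Reasoning
    regroup : ∀ d s a → d * s + a * d ≡ d * (a + s)
    regroup = solve-∀

  inflow-eliminate₀ : ∀ π j → inflow (eliminate₀ M) π j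
                              ≡ d * inflow (minor₀ M) π j + M zero (suc j) * inflowInto₀ M π
  inflow-eliminate₀ π j = begin
    sum (λ i → π i * (d * M (suc i) (suc j) + M (suc i) zero * M zero (suc j)))
      ≡⟨ sum-cong-≗ (λ i → expand (π i) d (M (suc i) (suc j)) (M (suc i) zero) (M zero (suc j))) ⟩
    sum (λ i → d * direct i + M zero (suc j) * via₀ i)
      ≡⟨ ∑-distrib-+ (λ i → d * direct i) (λ i → M zero (suc j) * via₀ i) ⟩
    sum (λ i → d * direct i) + sum (λ i → M zero (suc j) * via₀ i)
      ≡⟨ sym (cong₂ _+_ (*-distribˡ-sum d direct) (*-distribˡ-sum (M zero (suc j)) via₀)) ⟩
    d * inflow (minor₀ M) π j + M zero (suc j) * inflowInto₀ M π ∎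
    where
    open ≡-Reasoning
    direct via₀ : Fin N → ℕ
    direct i = π i * M (suc i) (suc j)
    via₀   i = π i * M (suc i) zero
    expand : ∀ p d a b c → p * (d * a + b * c) ≡ d * (p * a) + c * (p * b)
    expand = solve-∀

  balanced-eliminate₀ : ∀ {π} → Balanced (eliminate₀ M) π → Balanced M (lift₀ M π)
  balanced-eliminate₀ {π} balanced zero = begin
    π₀ * M zero zero + sum (λ i → d * π i * M (suc i) zero)
      ≡⟨ cong (π₀ * M zero zero +_) (sum-*-assoc d π (λ i → M (suc i) zero)) ⟩
    π₀ * M zero zero + d * π₀
      ≡⟨ regroup π₀ (M zero zero) d ⟩
    π₀ * outDegree M zero ∎
    where
    open ≡-Reasoning
    π₀ = inflowInto₀ M π
    regroup : ∀ p a d → p * a + d * p ≡ p * (a + d)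
    regroup = solve-∀
  balanced-eliminate₀ {π} balanced (suc j) = begin
    π₀ * M zero (suc j) + sum (λ i → d * π i * M (suc i) (suc j))
      ≡⟨ cong₂ _+_ (*-comm π₀ (M zero (suc j))) (sum-*-assoc d π (λ i → M (suc i) (suc j))) ⟩
    M zero (suc j) * π₀ + d * inflow (minor₀ M) π j
      ≡⟨ +-comm (M zero (suc j) * π₀) _ ⟩
    d * inflow (minor₀ M) π j + M zero (suc j) * π₀
      ≡⟨ sym (inflow-eliminate₀ π j) ⟩
    inflow (eliminate₀ M) π j
      ≡⟨ balanced j ⟩
    π j * outDegree (eliminate₀ M) j
      ≡⟨ cong (π j *_) (outDegree-eliminate₀ j) ⟩
    π j * (d * outDegree M (suc j))
      ≡⟨ regroup (π j) d (outDegree M (suc j)) ⟩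
    d * π j * outDegree M (suc j) ∎
    where
    open ≡-Reasoning
    π₀ = inflowInto₀ M π
    regroup : ∀ p d o → p * (d * o) ≡ d * p * o
    regroup = solve-∀

  module _ (d≢0 : d ≢ 0) where

    noArcIntoSink-eliminate₀ : NoArcIntoSink M → NoArcIntoSink (eliminate₀ M)
    noArcIntoSink-eliminate₀ noArcIntoSink j out≡0 i =
      cong₂ _+_ (*-≡0ʳ d (noArcIntoSink (suc j) sink (suc i)))
                (*-≡0ʳ (M (suc i) zero) (noArcIntoSink (suc j) sink zero))
      where
      sink : outDegree M (suc j) ≡ 0
      sink = *-≡0⇒≡0 d≢0 (trans (sym (outDegree-eliminate₀ j)) out≡0)

    nonSink-eliminate₀ : NoArcIntoSink M → ∃[ j ] outDegree (eliminate₀ M) j ≢ 0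
    nonSink-eliminate₀ noArcIntoSink with sum≢0⇒∃≢0 (λ j → M zero (suc j)) d≢0
    ... | j , M₀j≢0 = j , λ out≡0 → *-≢0 d≢0 (M₀j≢0 ∘ λ sink → noArcIntoSink (suc j) sink zero)
                                       (trans (sym (outDegree-eliminate₀ j)) out≡0)

    balancing-eliminate₀ : NontrivialBalancing (eliminate₀ M) → NontrivialBalancing M
    balancing-eliminate₀ (π , balanced , j , πj≢0 , outj≢0) =
        lift₀ M π , balanced-eliminate₀ balanced , suc j , *-≢0 d≢0 πj≢0
      , λ sink → outj≢0 (trans (outDegree-eliminate₀ j) (*-≡0ʳ d sink))

balancing-exists : ∀ {N} (M : Matrix N) → NoArcIntoSink M → ∃[ j ] outDegree M j ≢ 0 →
                   NontrivialBalancing M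
balancing-exists {zero}  M _ (() , _)
balancing-exists {suc N} M noArcIntoSink nonSink with outDegree M zero ≟ 0 | exitDegree₀ M ≟ 0
... | yes sink₀ | _ =
  balancing-minor₀ M noArcInto₀ (balancing-exists (minor₀ M)
    (noArcIntoSink-minor₀ M noArcInto₀ noArcIntoSink) (nonSink′ nonSink))
  where
  noArcInto₀ = noArcIntoSink zero sink₀
  nonSink′ : ∃[ j ] outDegree M j ≢ 0 → ∃[ j ] outDegree (minor₀ M) j ≢ 0
  nonSink′ (zero  , out₀≢0) = ⊥-elim (out₀≢0 sink₀)
  nonSink′ (suc j , outj≢0) = j , outj≢0 ∘ trans (sym (outDegree-minor₀ M noArcInto₀ j))
... | no out₀≢0 | yes exit≡0 = balancing-loop₀ M out₀≢0 exit≡0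
... | no _ | no exit≢0 =
  balancing-eliminate₀ M exit≢0 (balancing-exists (eliminate₀ M)
    (noArcIntoSink-eliminate₀ M exit≢0 noArcIntoSink) (nonSink-eliminate₀ M exit≢0 noArcIntoSink))

module BipartiteDigraph {m n} (P Q : Fin m → Fin n → ℕ) where

  arc : Fin m ⊎ Fin n → Fin m ⊎ Fin n → ℕ
  arc (inj₁ f) (inj₂ w) = P f w
  arc (inj₂ w) (inj₁ f) = Q f w
  arc _        _        = 0

  matrix : Matrix (m + n)
  matrix x y = arc (splitAt m x) (splitAt m y)

  matrix-FF : ∀ f f′ → matrix (f ↑ˡ n) (f′ ↑ˡ n) ≡ 0
  matrix-FF f f′ = cong₂ arc (splitAt-↑ˡ m f n) (splitAt-↑ˡ m f′ n)

  matrix-FW : ∀ f w → matrix (f ↑ˡ n) (m ↑ʳ w) ≡ P f w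
  matrix-FW f w = cong₂ arc (splitAt-↑ˡ m f n) (splitAt-↑ʳ m n w)

  matrix-WF : ∀ w f → matrix (m ↑ʳ w) (f ↑ˡ n) ≡ Q f w
  matrix-WF w f = cong₂ arc (splitAt-↑ʳ m n w) (splitAt-↑ˡ m f n)

  matrix-WW : ∀ w w′ → matrix (m ↑ʳ w) (m ↑ʳ w′) ≡ 0
  matrix-WW w w′ = cong₂ arc (splitAt-↑ʳ m n w) (splitAt-↑ʳ m n w′)

  outDegree-F : ∀ f → outDegree matrix (f ↑ˡ n) ≡ sum (P f)
  outDegree-F f = trans (sum-↑ m (matrix (f ↑ˡ n)))
                        (cong₂ _+_ (sum-≡0 (matrix-FF f)) (sum-cong-≗ (matrix-FW f)))

  outDegree-W : ∀ w → outDegree matrix (m ↑ʳ w) ≡ sum (λ f → Q f w)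
  outDegree-W w = trans (sum-↑ m (matrix (m ↑ʳ w)))
                        (trans (cong₂ _+_ (sum-cong-≗ (matrix-WF w)) (sum-≡0 (matrix-WW w)))
                               (+-identityʳ _))

  inflow-F : ∀ π f → inflow matrix π (f ↑ˡ n) ≡ sum (λ w → π (m ↑ʳ w) * Q f w)
  inflow-F π f = trans (sum-↑ m (λ x → π x * matrix x (f ↑ˡ n))) (cong₂ _+_
    (sum-≡0 (λ f′ → *-≡0ʳ (π (f′ ↑ˡ n)) (matrix-FF f′ f)))
    (sum-cong-≗ (λ w → cong (π (m ↑ʳ w) *_) (matrix-WF w f))))

  inflow-W : ∀ π w → inflow matrix π (m ↑ʳ w) ≡ sum (λ f → π (f ↑ˡ n) * P f w)
  inflow-W π w = trans (sum-↑ m (λ x → π x * matrix x (m ↑ʳ w))) (trans (cong₂ _+_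
    (sum-cong-≗ (λ f → cong (π (f ↑ˡ n) *_) (matrix-FW f w)))
    (sum-≡0 (λ w′ → *-≡0ʳ (π (m ↑ʳ w′)) (matrix-WW w′ w)))) (+-identityʳ _))

  noArcIntoSink-matrix : (∀ f w → P f w ≢ 0 → ∃[ f′ ] Q f′ w ≢ 0) →
                         (∀ f w → Q f w ≢ 0 → ∃[ w′ ] P f w′ ≢ 0) → NoArcIntoSink matrix
  noArcIntoSink-matrix P⇒Q Q⇒P y sink x with side m n x | side m n y
  ... | inˡ f | inˡ f′ = matrix-FF f f′
  ... | inʳ w | inʳ w′ = matrix-WW w w′
  ... | inˡ f | inʳ w  = trans (matrix-FW f w) (decidable-stable (P f w ≟ 0) λ Pfw≢0 →
                           ∃≢0⇒sum≢0 (P⇒Q f w Pfw≢0) (trans (sym (outDegree-W w)) sink))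
  ... | inʳ w | inˡ f  = trans (matrix-WF w f) (decidable-stable (Q f w ≟ 0) λ Qfw≢0 →
                           ∃≢0⇒sum≢0 (Q⇒P f w Qfw≢0) (trans (sym (outDegree-F f)) sink))

  module _ {π : Fin (m + n) → ℕ} (balanced : Balanced matrix π) where

    activeF : ∀ f → π (f ↑ˡ n) ≢ 0 → outDegree matrix (f ↑ˡ n) ≢ 0 →
              ∃[ f ] ∃[ w ] (P f w ≢ 0 × π (f ↑ˡ n) ≢ 0)
    activeF f πf≢0 out≢0 with sum≢0⇒∃≢0 (P f) (out≢0 ∘ trans (outDegree-F f))
    ... | w , Pfw≢0 = f , w , Pfw≢0 , πf≢0

    activeW : ∀ w → π (m ↑ʳ w) ≢ 0 → outDegree matrix (m ↑ʳ w) ≢ 0 →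
              ∃[ f ] ∃[ w ] (Q f w ≢ 0 × π (m ↑ʳ w) ≢ 0)
    activeW w πw≢0 out≢0 with sum≢0⇒∃≢0 (λ f → Q f w) (out≢0 ∘ trans (outDegree-W w))
    ... | f , Qfw≢0 = f , w , Qfw≢0 , πw≢0

    -- An active vertex has an active successor, and one of the two lies in each class.
    active⇒bothClassesActive : ∀ {x} → π x ≢ 0 → outDegree matrix x ≢ 0 →
                               (∃[ f ] ∃[ w ] (P f w ≢ 0 × π (f ↑ˡ n) ≢ 0)) ×
                               (∃[ f ] ∃[ w ] (Q f w ≢ 0 × π (m ↑ʳ w) ≢ 0))
    active⇒bothClassesActive {x} πx≢0 outx≢0 with sum≢0⇒∃≢0 (matrix x) outx≢0
    ... | y , Mxy≢0 with balanced-successor {M = matrix} balanced πx≢0 Mxy≢0 | side m n x | side m n y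
    ... | πy≢0 , outy≢0 | inˡ f | inʳ w  = activeF f πx≢0 outx≢0 , activeW w πy≢0 outy≢0
    ... | πy≢0 , outy≢0 | inʳ w | inˡ f  = activeF f πy≢0 outy≢0 , activeW w πx≢0 outx≢0
    ... | _             | inˡ f | inˡ f′ = ⊥-elim (Mxy≢0 (matrix-FF f f′))
    ... | _             | inʳ w | inʳ w′ = ⊥-elim (Mxy≢0 (matrix-WW w w′))

  balancing : (∀ f w → P f w ≢ 0 → ∃[ f′ ] Q f′ w ≢ 0) →
              (∀ f w → Q f w ≢ 0 → ∃[ w′ ] P f w′ ≢ 0) →
              ∃[ f ] ∃[ w ] P f w ≢ 0 →
              Σ[ a ∈ (Fin m → ℕ) ] Σ[ b ∈ (Fin n → ℕ) ]
                ( (∀ f → sum (λ w → a f * P f w) ≡ sum (λ w → b w * Q f w))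
                × (∀ w → sum (λ f → a f * P f w) ≡ sum (λ f → b w * Q f w))
                × (∃[ f ] ∃[ w ] (P f w ≢ 0 × a f ≢ 0))
                × (∃[ f ] ∃[ w ] (Q f w ≢ 0 × b w ≢ 0)) )
  balancing P⇒Q Q⇒P (f₀ , w₀ , Pf₀w₀≢0)
    with balancing-exists matrix (noArcIntoSink-matrix P⇒Q Q⇒P) (f₀ ↑ˡ n , nonSink)
    where
    nonSink : outDegree matrix (f₀ ↑ˡ n) ≢ 0
    nonSink = ∃≢0⇒sum≢0 (w₀ , Pf₀w₀≢0) ∘ trans (sym (outDegree-F f₀))
  ... | π , balanced , x , πx≢0 , outx≢0 =
    a , b , balance-F , balance-W , active⇒bothClassesActive balanced πx≢0 outx≢0
    where
    open ≡-Reasoning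
    a : Fin m → ℕ
    a = π ∘ (_↑ˡ n)
    b : Fin n → ℕ
    b = π ∘ (m ↑ʳ_)
    balance-F : ∀ f → sum (λ w → a f * P f w) ≡ sum (λ w → b w * Q f w)
    balance-F f = begin
      sum (λ w → a f * P f w)         ≡⟨ sym (*-distribˡ-sum (a f) (P f)) ⟩
      a f * sum (P f)                 ≡⟨ cong (a f *_) (sym (outDegree-F f)) ⟩
      a f * outDegree matrix (f ↑ˡ n) ≡⟨ sym (balanced (f ↑ˡ n)) ⟩
      inflow matrix π (f ↑ˡ n)        ≡⟨ inflow-F π f ⟩
      sum (λ w → b w * Q f w)         ∎
    balance-W : ∀ w → sum (λ f → a f * P f w) ≡ sum (λ f → b w * Q f w)
    balance-W w = begin
      sum (λ f → a f * P f w)          ≡⟨ sym (inflow-W π w) ⟩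
      inflow matrix π (m ↑ʳ w)         ≡⟨ balanced (m ↑ʳ w) ⟩
      b w * outDegree matrix (m ↑ʳ w)  ≡⟨ cong (b w *_) (outDegree-W w) ⟩
      b w * sum (λ f → Q f w)          ≡⟨ *-distribˡ-sum (b w) (λ f → Q f w) ⟩
      sum (λ f → b w * Q f w)          ∎

𝟙 : Bool → ℕ
𝟙 true  = 1
𝟙 false = 0

𝟙≢0⇒≡true : ∀ {c} → 𝟙 c ≢ 0 → c ≡ true
𝟙≢0⇒≡true {true}  _   = refl
𝟙≢0⇒≡true {false} 0≢0 = ⊥-elim (0≢0 refl)

≡true⇒𝟙≢0 : ∀ {c} → c ≡ true → 𝟙 c ≢ 0
≡true⇒𝟙≢0 refl ()

toℚ : ℕ → ℚ
toℚ k = k ·ℚ 1ℚ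

toℚ-nonNegative : ∀ k → NonNegative (toℚ k)
toℚ-nonNegative zero    = _
toℚ-nonNegative (suc k) = ℚₚ.nonNeg+nonNeg⇒nonNeg 1ℚ (toℚ k) {{toℚ-nonNegative k}}

0≤toℚ : ∀ k → 0ℚ ≤ toℚ k
0≤toℚ k = ℚₚ.nonNegative⁻¹ (toℚ k) {{toℚ-nonNegative k}}

toℚ-≢0 : ∀ {k} → k ≢ 0 → toℚ k ≢ 0ℚ
toℚ-≢0 {zero}  0≢0 = ⊥-elim (0≢0 refl)
toℚ-≢0 {suc k} _   = ℚₚ.<⇒≢ (ℚₚ.positive⁻¹ (toℚ (suc k)) {{positive}}) ∘ sym
  where positive = ℚₚ.pos+nonNeg⇒pos 1ℚ (toℚ k) {{toℚ-nonNegative k}}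

if-toℚ : ∀ c x → (if c then toℚ x else 0ℚ) ≡ toℚ (x * 𝟙 c)
if-toℚ true  x = cong toℚ (sym (*-identityʳ x))
if-toℚ false x = cong toℚ (sym (*-zeroʳ x))

sumℚ-if-toℚ : ∀ k (c : Fin k → Bool) (x : Fin k → ℕ) →
              sumℚ k (λ i → if c i then toℚ (x i) else 0ℚ) ≡ toℚ (sum (λ i → x i * 𝟙 (c i)))
sumℚ-if-toℚ zero    c x = refl
sumℚ-if-toℚ (suc k) c x =
  trans (cong₂ ℚ._+_ (if-toℚ (c zero) (x zero)) (sumℚ-if-toℚ k (c ∘ suc) (x ∘ suc)))
        (sym (×-homo-+ 1ℚ (x zero * 𝟙 (c zero)) (sum (λ i → x (suc i) * 𝟙 (c (suc i))))))

sumℚ-if-toℚ-cong : ∀ k (c c′ : Fin k → Bool) (x x′ : Fin k → ℕ) →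
                   sum (λ i → x i * 𝟙 (c i)) ≡ sum (λ i → x′ i * 𝟙 (c′ i)) →
                   sumℚ k (λ i → if c i then toℚ (x i) else 0ℚ)
                   ≡ sumℚ k (λ i → if c′ i then toℚ (x′ i) else 0ℚ)
sumℚ-if-toℚ-cong k c c′ x x′ eq =
  trans (sumℚ-if-toℚ k c x) (trans (cong toℚ eq) (sym (sumℚ-if-toℚ k c′ x′)))

lemma6 : (m n : ℕ) (E A B : EdgeSet m n) →
         A ⊆ₑ E → B ⊆ₑ E → Disjointₑ A B → NonEmptyₑ A → NonEmptyₑ B →
         (∀ f w → A ∋ f , w → ∃[ f′ ] (B ∋ f′ , w)) →
         (∀ f w → B ∋ f , w → ∃[ w′ ] (A ∋ f , w′)) →
         ∃[ α ] ∃[ β ]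
           ( NonnegNonzeroOn A α × NonnegNonzeroOn B β
           × (∀ f → InJF A B f → sumAtF A α f ≡ sumAtF B β f)
           × (∀ w → InJW A B w → sumAtW A α w ≡ sumAtW B β w)
           × (∀ f → InJF A B f → ∀ w w′ → A ∋ f , w → A ∋ f , w′ → α f w ≡ α f w′)
           × (∀ w → InJW A B w → ∀ f f′ → B ∋ f , w → B ∋ f′ , w → β f w ≡ β f′ w) )
lemma6 m n E A B _ _ _ (f₀ , w₀ , f₀w₀∈A) _ A⇒B B⇒A
  with BipartiteDigraph.balancing (𝟙 ∘₂ A) (𝟙 ∘₂ B) A⇒B′ B⇒A′ (f₀ , w₀ , ≡true⇒𝟙≢0 f₀w₀∈A)
  where
  A⇒B′ : ∀ f w → 𝟙 (A f w) ≢ 0 → ∃[ f′ ] 𝟙 (B f′ w) ≢ 0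
  A⇒B′ f w Afw≢0 with A⇒B f w (𝟙≢0⇒≡true Afw≢0)
  ... | f′ , f′w∈B = f′ , ≡true⇒𝟙≢0 f′w∈B
  B⇒A′ : ∀ f w → 𝟙 (B f w) ≢ 0 → ∃[ w′ ] 𝟙 (A f w′) ≢ 0
  B⇒A′ f w Bfw≢0 with B⇒A f w (𝟙≢0⇒≡true Bfw≢0)
  ... | w′ , fw′∈A = w′ , ≡true⇒𝟙≢0 fw′∈A
... | a , b , balance-F , balance-W , (f , w , Afw≢0 , af≢0) , (f′ , w′ , Bf′w′≢0 , bw′≢0) =
    (λ f _ → toℚ (a f)) , (λ _ w → toℚ (b w))
  , ((λ f _ _ → 0≤toℚ (a f)) , f , w , 𝟙≢0⇒≡true Afw≢0 , toℚ-≢0 af≢0)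
  , ((λ _ w _ → 0≤toℚ (b w)) , f′ , w′ , 𝟙≢0⇒≡true Bf′w′≢0 , toℚ-≢0 bw′≢0)
  , (λ f _ → sumℚ-if-toℚ-cong n (A f) (B f) (λ _ → a f) b (balance-F f))
  , (λ w _ → sumℚ-if-toℚ-cong m (λ f → A f w) (λ f → B f w) a (λ _ → b w) (balance-W w))
  , (λ _ _ _ _ _ _ → refl)
  , (λ _ _ _ _ _ _ → refl)
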